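{- Let $(V,H)$ be a $3$-uniform hypergraph with finite vertex set $V$ in which no line is universal. Let $\mathcal{L}$ be the set of all lines, and define $\alpha,\beta:V\to 2^{\mathcal{L}}$ by $\alpha(x)=\{L\in\mathcal{L}: x\in L\}$ and $\beta(x)=\{\overline{xw}: w\in V,\ w\neq x\}$. If $x,y,z$ are vertices with $y\neq x$, $z\neq x$ and $\overline{xy}=\overline{xz}$, then $\alpha(y)\cap\beta(x)=\alpha(z)\cap\beta(x)$.
   Context: A $3$-uniform hypergraph is a pair $(V,H)$ where $H$ is a family of $3$-element subsets of $V$ (called hedges). For distinct vertices $u,v$, the line $\overline{uv}$ is defined as $\overline{uv}=\{u,v\}\cup\{p\in V:\{u,v,p\}\in H\}$. A line is universal if it equals $V$. -}

module Defs where

open import Data.Nat using (ℕ)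
open import Data.Fin using (Fin)
open import Data.Fin.Subset using (Subset; _∈_; ⁅_⁆; _∪_; ∣_∣; ⊤)
open import Data.List using (List)
import Data.List.Membership.Propositional as LM
open import Data.List.Relation.Unary.All using (All)
open import Data.Product using (Σ; ∃; _×_)
open import Relation.Binary.PropositionalEquality using (_≡_; _≢_)
open import Relation.Nullary using (¬_)

record Hypergraph3 (n : ℕ) : Set where
  field
    hedges  : List (Subset n)
    uniform : All (λ e → ∣ e ∣ ≡ 3) hedges
open Hypergraph3 public

IsHedge : ∀ {n} → Hypergraph3 n → Fin n → Fin n → Fin n → Set
IsHedge G u v p = (⁅ u ⁆ ∪ ⁅ v ⁆ ∪ ⁅ p ⁆) LM.∈ hedges G

InLine : ∀ {n} → Hypergraph3 n → Fin n → Fin n → Fin n → Set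
InLine G u v x = (x ≡ u) Data.Sum.⊎ ((x ≡ v) Data.Sum.⊎ IsHedge G u v x)
  where import Data.Sum

VSet : ℕ → Set₁
VSet n = Fin n → Set

_≐_ : ∀ {n} → VSet n → VSet n → Set
A ≐ B = ∀ x → (A x → B x) × (B x → A x)

line : ∀ {n} → Hypergraph3 n → Fin n → Fin n → VSet n
line G u v = InLine G u v

Universal : ∀ {n} → VSet n → Set
Universal L = ∀ x → L x

NoUniversalLine : ∀ {n} → Hypergraph3 n → Set
NoUniversalLine G = ∀ u v → u ≢ v → ¬ Universal (line G u v)

IsLine : ∀ {n} → Hypergraph3 n → VSet n → Set
IsLine G L = ∃ λ u → ∃ λ v → u ≢ v × (L ≐ line G u v)

α : ∀ {n} → Hypergraph3 n → Fin n → VSet n → Set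
α G x L = IsLine G L × L x

β : ∀ {n} → Hypergraph3 n → Fin n → VSet n → Set
β G x L = ∃ λ w → w ≢ x × (L ≐ line G x w)

_≋_ : ∀ {n} → (VSet n → Set) → (VSet n → Set) → Set₁
𝓐 ≋ 𝓑 = ∀ L → (𝓐 L → 𝓑 L) × (𝓑 L → 𝓐 L)

_⊓_ : ∀ {n} → (VSet n → Set) → (VSet n → Set) → (VSet n → Set)
(𝓐 ⊓ 𝓑) L = 𝓐 L × 𝓑 L

module Submission where

open import Defs
open import Data.Fin using (Fin)
open import Data.Fin.Subset using (⁅_⁆; _∪_)
open import Data.Fin.Subset.Properties using (∪-comm)
import Data.List.Membership.Propositional as LM
open import Data.Sum using (inj₁; inj₂)
open import Data.Product using (_,_; proj₁; proj₂)
open import Data.Empty using (⊥-elim)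
open import Relation.Binary.PropositionalEquality using (_≢_; refl; subst; cong)

-- For u, v distinct from x: u ∈ xv iff v ∈ xu, since both say u = v or {x,u,v} ∈ H.
-- Hence every line xw through y also passes through z, as w ∈ xy = xz.

≐-sym : ∀ {n} {A B : VSet n} → A ≐ B → B ≐ A
≐-sym A≐B v = proj₂ (A≐B v) , proj₁ (A≐B v)

IsHedge-swap : ∀ {n} (G : Hypergraph3 n) (x u v : Fin n) → IsHedge G x u v → IsHedge G x v u
IsHedge-swap G x u v = subst (LM._∈ hedges G) (cong (⁅ x ⁆ ∪_) (∪-comm ⁅ u ⁆ ⁅ v ⁆))

line-swap : ∀ {n} (G : Hypergraph3 n) {x u v : Fin n} → u ≢ x → line G x v u → line G x u v
line-swap G u≢x (inj₁ u≡x)          = ⊥-elim (u≢x u≡x)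
line-swap G u≢x (inj₂ (inj₁ refl))  = inj₂ (inj₁ refl)
line-swap G u≢x (inj₂ (inj₂ hedge))    = inj₂ (inj₂ (IsHedge-swap G _ _ _ hedge))

line-transfer : ∀ {n} (G : Hypergraph3 n) {x y z w : Fin n} → y ≢ x → w ≢ x →
  line G x y ≐ line G x z → line G x w y → line G x w z
line-transfer G {w = w} y≢x w≢x xy≐xz y∈xw =
  line-swap G w≢x (proj₁ (xy≐xz w) (line-swap G y≢x y∈xw))

α⊓β-transfer : ∀ {n} (G : Hypergraph3 n) {x y z : Fin n} → y ≢ x →
  line G x y ≐ line G x z → ∀ L → (α G y ⊓ β G x) L → (α G z ⊓ β G x) L
α⊓β-transfer G y≢x xy≐xz L ((L-line , y∈L) , (w , w≢x , L≐xw)) =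
  (L-line , proj₂ (L≐xw _) (line-transfer G y≢x w≢x xy≐xz (proj₁ (L≐xw _) y∈L)))
  , (w , w≢x , L≐xw)

lemma2 : ∀ {n} (G : Hypergraph3 n) → NoUniversalLine G →
    (x y z : Fin n) → y ≢ x → z ≢ x → line G x y ≐ line G x z →
    (α G y ⊓ β G x) ≋ (α G z ⊓ β G x)
lemma2 G _ x y z y≢x z≢x xy≐xz L =
  α⊓β-transfer G y≢x xy≐xz L , α⊓β-transfer G z≢x (≐-sym xy≐xz) L
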